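{- Let $j\in\mathbb N$ and let $R_1,\dots,R_j$ be rings. For each $i$, let $\{N_{i1},\dots,N_{ik_i}\}$ be a collection of ideals of $R_i$ satisfying the CNC-condition, and let $s_{il}$ be the characteristic of $N_{il}$ in $N_{i(l+1)}$ for $1\le l\le k_i-1$. Suppose $(R_i/N_{i1})^*$ is finite for all $1\le i\le j$. Let $m_i=|(R_i/N_{i1})^*|\,s_{i1}s_{i2}\cdots s_{i(k_i-1)}$ and let $M$ be the least common multiple of $m_1,\dots,m_j$. Then $y^M=(1_{R_1},\dots,1_{R_j})$ for all $y=(y_1,\dots,y_j)\in R_1^*\times\cdots\times R_j^*$.
   Context: Rings are associative with identity, not necessarily commutative; $S^*$ denotes the group of units of a ring $S$. A collection $\{N_1,\dots,N_k\}$ of ideals of a ring $R$ satisfies the CNC-condition if: (i) $\{0\}=N_k\subset N_{k-1}\subset\cdots\subset N_1\subset R$; (ii) for each $i=1,\dots,k-1$ there is $t_i\ge 2$ with $N_i^{t_i}\subset N_{i+1}$ (the minimal such $t_i$ is the nilpotency index of $N_i$ in $N_{i+1}$); (iii) for each $i=1,\dots,k-1$ there is $s_i\ge 1$ with $s_iN_i\subset N_{i+1}$ and all prime factors of $s_i$ are $\ge t_i$; the minimal such $s_i$ is called the characteristic of $N_i$ in $N_{i+1}$. -}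

module Defs where

open import Level using (Level; _⊔_; Lift) renaming (suc to lsuc)
open import Data.Unit.Polymorphic using (⊤)
open import Algebra.Bundles using (Ring; Semiring)
import Algebra.Definitions.RawSemiring as RS
open import Data.Nat as ℕ using (ℕ; zero; _≤_; _≥_)
open import Data.Nat.Divisibility as ND using ()
open import Data.Nat.Primality using (Prime)
open import Data.Nat.LCM using (lcm)
open import Data.Fin using (Fin; zero; suc; inject₁; fromℕ)
open import Data.Product using (Σ; ∃; _×_; _,_)
open import Relation.Binary.PropositionalEquality using (_≡_)

prodFin : (n : ℕ) → (Fin n → ℕ) → ℕ
prodFin zero f = 1
prodFin (ℕ.suc n) f = f zero ℕ.* prodFin n (λ i → f (suc i))

lcmFin : (n : ℕ) → (Fin n → ℕ) → ℕ
lcmFin zero f = 1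
lcmFin (ℕ.suc n) f = lcm (f zero) (lcmFin n (λ i → f (suc i)))

module RingDefs {c ℓ : Level} (R : Ring c ℓ) where
  open Ring R
  open RS (Semiring.rawSemiring semiring) public using (_^_) renaming (_×_ to _·ₙ_)

  IsUnit : Carrier → Set (c ⊔ ℓ)
  IsUnit x = Σ Carrier λ y → (x * y ≈ 1#) × (y * x ≈ 1#)

  record IsIdeal {p : Level} (N : Carrier → Set p) : Set (c ⊔ ℓ ⊔ p) where
    field
      resp  : ∀ {x y} → x ≈ y → N x → N y
      zero∈ : N 0#
      +∈    : ∀ {x y} → N x → N y → N (x + y)
      -∈    : ∀ {x} → N x → N (- x)
      *ˡ∈   : ∀ r {x} → N x → N (r * x)
      *ʳ∈   : ∀ r {x} → N x → N (x * r)

  record Ideal (p : Level) : Set (c ⊔ ℓ ⊔ lsuc p) where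
    field
      mem     : Carrier → Set p
      isIdeal : IsIdeal mem

  open Ideal public

  _⊆_ : ∀ {p q} → (Carrier → Set p) → (Carrier → Set q) → Set (c ⊔ p ⊔ q)
  A ⊆ B = ∀ {x} → A x → B x

  data IdealProd {p q} (I : Carrier → Set p) (J : Carrier → Set q) : Carrier → Set (c ⊔ ℓ ⊔ p ⊔ q) where
    prod : ∀ {a b} → I a → J b → IdealProd I J (a * b)
    zro  : IdealProd I J 0#
    add  : ∀ {x y} → IdealProd I J x → IdealProd I J y → IdealProd I J (x + y)
    neg  : ∀ {x} → IdealProd I J x → IdealProd I J (- x)
    rsp  : ∀ {x y} → x ≈ y → IdealProd I J x → IdealProd I J y

  IdealPow : ∀ {p} → (Carrier → Set p) → ℕ → Carrier → Set (c ⊔ ℓ ⊔ p)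
  IdealPow {p} N zero x = ⊤  -- N^0 = R (convention; only t ≥ 2 is ever used)
  IdealPow {p} N (ℕ.suc zero) x = Lift (c ⊔ ℓ ⊔ p) (N x)
  IdealPow {p} N (ℕ.suc (ℕ.suc t)) x = IdealProd (IdealPow N (ℕ.suc t)) N x

  IsNilIndex : ∀ {p} → Ideal p → Ideal p → ℕ → Set (c ⊔ ℓ ⊔ p)
  IsNilIndex N N′ t =
    (t ≥ 2) × (IdealPow (mem N) t ⊆ mem N′)
    × (∀ t′ → t′ ≥ 2 → IdealPow (mem N) t′ ⊆ mem N′ → t ≤ t′)

  AdmChar : ∀ {p} → Ideal p → Ideal p → ℕ → ℕ → Set (c ⊔ p)
  AdmChar N N′ t s =
    (s ≥ 1) × (∀ {x} → mem N x → mem N′ (s ·ₙ x))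
    × (∀ q → Prime q → q ND.∣ s → t ≤ q)

  IsCharacteristic : ∀ {p} → Ideal p → Ideal p → ℕ → ℕ → Set (c ⊔ p)
  IsCharacteristic N N′ t s = AdmChar N N′ t s × (∀ s′ → AdmChar N N′ t s′ → s ≤ s′)

  -- CNC-condition for a chain N : Fin (suc k′) → Ideal (N zero = N₁, ..., N (fromℕ k′) = N_k),
  -- with t l the nilpotency index and s l the characteristic of N_l in N_{l+1}
  record CNC {p} (k′ : ℕ) (N : Fin (ℕ.suc k′) → Ideal p)
             (t s : Fin k′ → ℕ) : Set (c ⊔ ℓ ⊔ p) where
    field
      last-zero : ∀ {x} → mem (N (fromℕ k′)) x → x ≈ 0#
      chain     : ∀ l → mem (N (suc l)) ⊆ mem (N (inject₁ l))
      nilIndex  : ∀ l → IsNilIndex (N (inject₁ l)) (N (suc l)) (t l)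
      charac    : ∀ l → IsCharacteristic (N (inject₁ l)) (N (suc l)) (t l) (s l)

  IsUnitMod : ∀ {p} → Ideal p → Carrier → Set (c ⊔ p)
  IsUnitMod N x = Σ Carrier λ y → mem N (x * y - 1#) × mem N (y * x - 1#)

  -- (R/N)^* is finite with exactly n elements: a bijection Fin n ≅ (R/N)^*, given by
  -- representatives f i of pairwise distinct classes exhausting all unit classes
  UnitsModCard : ∀ {p} → Ideal p → ℕ → Set (c ⊔ p)
  UnitsModCard {p} N n =
    Σ (Fin n → Carrier) λ f →
      (∀ i → IsUnitMod N (f i))
      × (∀ i i′ → mem N (f i - f i′) → i ≡ i′)
      × (∀ x → IsUnitMod N x → ∃ λ i → mem N (x - f i))

{-# OPTIONS --safe #-}
-- Fix i and write N = N_{i1}. Left multiplication by the unit y permutes the u unit classes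
-- of R/N, and y^k fixes one class iff y^k ≡ 1 (mod N) iff it fixes all of them. So every orbit
-- of this permutation has the same length d; removing orbits one at a time shows d ∣ u, hence
-- y^u ≡ 1 (mod N).
-- Next, x ≡ 1 (mod N_l) implies x^{s_l} ≡ 1 (mod N_{l+1}). Expand ((x - 1) + 1)^{s_l}: the
-- terms C(s_l, r) (x - 1)^r with r ≥ t_l lie in N_l^{t_l} ⊆ N_{l+1}; for 0 < r < t_l every
-- prime factor of s_l exceeds r, so s_l is coprime to r and divides C(s_l, r), and
-- s_l N_l ⊆ N_{l+1}. Walking down the chain gives y^{m_i} - 1 ∈ N_{ik_i} = 0, and m_i ∣ M.
module Submission where

open import Defs
open import Level using (Level; 0ℓ; lift)
open import Algebra.Bundles using (Ring)
open import Data.Fin.Base using (Fin; zero; suc; toℕ; inject₁; fromℕ)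
open import Data.Nat.Base as ℕ using (ℕ; zero; suc; _∸_)
import Data.Nat.Properties as ℕ
open import Data.Nat.Combinatorics using (_C_)
open import Data.Nat.Divisibility using (_∣_; divides; ∣-trans)
open import Data.Nat.LCM using (m∣lcm[m,n]; n∣lcm[m,n])
open import Data.Nat.Primality using (_Rough_)
open import Data.Product using (∃-syntax; _×_; _,_; proj₁; proj₂)
open import Function.Base using (_∘_)
open import Function.Definitions using (Injective)
open import Relation.Binary.Bundles using (Setoid)
open import Relation.Nullary using (yes; no)
open import Relation.Binary.PropositionalEquality as ≡ using (_≡_)

module Combinatorics where

  open import Data.Bool.Base using (if_then_else_)
  open import Data.Empty using (⊥; ⊥-elim)
  open import Data.Fin.Properties using (_≟_; any?; pigeonhole)
  open import Data.Nat.Base using (pred; NonZero; >-nonZero⁻¹; >-nonZero; _+_; _*_; _≤_; _<_)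
  open import Data.Nat.Divisibility using (_∣0; ∣-refl; ∣m∣n⇒∣m+n)
  open import Data.Nat.Induction using (<-rec)
  open import Data.Nat.Properties
    using ( +-0-commutativeMonoid; _<?_; anyUpTo?; m+[n∸m]≡n; m<n⇒0<n∸m; m∸n≤m; ≤-<-trans; <⇒≤
          ; ≤-refl; ≤-reflexive; n<1+n; m<n⇒m<1+n; m<1+n⇒m<n∨m≡n; <-irrefl; <-cmp; suc-pred
          ; <-trans; m<n+m)
  open import Data.Sum using (_⊎_; inj₁; inj₂)
  open import Data.Unit.Base using (tt)
  open import Relation.Nullary using (¬_; Dec; does; _⊎-dec_; _×-dec_)
  open import Relation.Unary using (Pred; Decidable; U; _∩_; ∁)
  open import Relation.Unary.Properties using (_∩?_; _∪?_; ∁?)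
  open import Relation.Binary.PropositionalEquality
  open import Relation.Binary.Definitions using (tri<; tri≈; tri>)
  open import Algebra.Properties.CommutativeMonoid.Sum +-0-commutativeMonoid
    using (sum-syntax; ∑-distrib-+; sum-cong-≗; sum-replicate-zero)

  iterate : ∀ {a} {A : Set a} → (A → A) → ℕ → A → A
  iterate f zero    x = x
  iterate f (suc k) x = f (iterate f k x)

  module _ {a} {A : Set a} (f : A → A) where

    iterate-+ : ∀ m n x → iterate f (m + n) x ≡ iterate f m (iterate f n x)
    iterate-+ zero    n x = refl
    iterate-+ (suc m) n x = cong f (iterate-+ m n x)

    iterate-∣-fixed : ∀ {m n x} → iterate f n x ≡ x → n ∣ m → iterate f m x ≡ x
    iterate-∣-fixed fx (divides zero    refl) = refl
    iterate-∣-fixed {n = n} {x} fx (divides (suc q) refl) = begin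
      iterate f (n + q * n) x           ≡⟨ iterate-+ n (q * n) x ⟩
      iterate f n (iterate f (q * n) x) ≡⟨ cong (iterate f n) (iterate-∣-fixed fx (divides q refl)) ⟩
      iterate f n x                     ≡⟨ fx ⟩
      x                                 ∎
      where open ≡-Reasoning

    iterate-injective : Injective _≡_ _≡_ f → ∀ k → Injective _≡_ _≡_ (iterate f k)
    iterate-injective f-inj zero    eq = eq
    iterate-injective f-inj (suc k) eq = iterate-injective f-inj k (f-inj eq)

  least : ∀ {p} {P : Pred ℕ p} → Decidable P → ∀ {n} → P n →
          ∃[ m ] P m × (∀ {k} → k < m → ¬ P k)
  least {P = P} P? = <-rec (λ n → P n → Least) step _
    where
    Least : Set _
    Least = ∃[ m ] P m × (∀ {k} → k < m → ¬ P k)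
    step : ∀ n → (∀ {k} → k < n → P k → Least) → P n → Least
    step n rec Pn with anyUpTo? P? n
    ... | yes (k , k<n , Pk) = rec k<n Pk
    ... | no ∄k              = n , Pn , λ k<n Pk → ∄k (_ , k<n , Pk)

  indicator : ∀ {p} {P : Set p} → Dec P → ℕ
  indicator P? = if does P? then 1 else 0

  indicator-⊎ : ∀ {p q} {P : Set p} {Q : Set q} (P? : Dec P) (Q? : Dec Q) →
                (P → Q → ⊥) → indicator (P? ⊎-dec Q?) ≡ indicator P? + indicator Q?
  indicator-⊎ (yes p) (yes q) disj = ⊥-elim (disj p q)
  indicator-⊎ (yes _) (no _)  _    = refl
  indicator-⊎ (no _)  _       _    = refl

  indicator-cong : ∀ {p q} {P : Set p} {Q : Set q} (P? : Dec P) (Q? : Dec Q) →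
                   (P → Q) → (Q → P) → indicator P? ≡ indicator Q?
  indicator-cong (yes _) (yes _) _   _   = refl
  indicator-cong (yes p) (no ¬q) P⇒Q _   = ⊥-elim (¬q (P⇒Q p))
  indicator-cong (no ¬p) (yes q) _   Q⇒P = ⊥-elim (¬p (Q⇒P q))
  indicator-cong (no _)  (no _)  _   _   = refl

  module _ {n : ℕ} where

    count : ∀ {p} {P : Pred (Fin n) p} → Decidable P → ℕ
    count P? = ∑[ j < n ] indicator (P? j)

    module _ {p q} {P : Pred (Fin n) p} {Q : Pred (Fin n) q} (P? : Decidable P) (Q? : Decidable Q) where

      count-cong : (∀ {j} → P j → Q j) → (∀ {j} → Q j → P j) → count P? ≡ count Q?
      count-cong P⇒Q Q⇒P = sum-cong-≗ λ j → indicator-cong (P? j) (Q? j) P⇒Q Q⇒P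

      count-∪ : (∀ {j} → P j → Q j → ⊥) → count (P? ∪? Q?) ≡ count P? + count Q?
      count-∪ disj = trans (sum-cong-≗ λ j → indicator-⊎ (P? j) (Q? j) disj)
                           (∑-distrib-+ (indicator ∘ P?) (indicator ∘ Q?))

    count-∩∁ : ∀ {p q} {P : Pred (Fin n) p} {Q : Pred (Fin n) q}
               (P? : Decidable P) (Q? : Decidable Q) →
               count P? ≡ count (P? ∩? Q?) + count (P? ∩? ∁? Q?)
    count-∩∁ {P = P} {Q} P? Q? =
      trans (count-cong P? ((P? ∩? Q?) ∪? (P? ∩? ∁? Q?)) split join)
            (count-∪ (P? ∩? Q?) (P? ∩? ∁? Q?) λ (_ , q) (_ , ¬q) → ¬q q)
      where
      split : ∀ {j} → P j → (P ∩ Q) j ⊎ (P ∩ ∁ Q) j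
      split {j} p with Q? j
      ... | yes q = inj₁ (p , q)
      ... | no ¬q = inj₂ (p , ¬q)
      join : ∀ {j} → (P ∩ Q) j ⊎ (P ∩ ∁ Q) j → P j
      join (inj₁ (p , _)) = p
      join (inj₂ (p , _)) = p

    count-∅ : ∀ {p} {P : Pred (Fin n) p} (P? : Decidable P) → (∀ j → ¬ P j) → count P? ≡ 0
    count-∅ P? ∄ = trans (sum-cong-≗ zero-at) (sum-replicate-zero n)
      where
      zero-at : ∀ j → indicator (P? j) ≡ 0
      zero-at j with P? j
      ... | yes Pj = ⊥-elim (∄ j Pj)
      ... | no _   = refl

  count-U : ∀ n → count {n} {P = U} (λ _ → yes tt) ≡ n
  count-U zero    = refl
  count-U (suc n) = cong suc (count-U n)

  count-≡ : ∀ {n} (i : Fin n) → count (i ≟_) ≡ 1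
  count-≡ {suc n} zero    = cong suc (count-∅ {n} (λ j → zero ≟ suc j) λ _ ())
  count-≡ {suc n} (suc i) = count-≡ i

  Image : ∀ {n} → (ℕ → Fin n) → ℕ → Pred (Fin n) 0ℓ
  Image f d j = ∃[ k ] k < d × f k ≡ j

  image? : ∀ {n} (f : ℕ → Fin n) d → Decidable (Image f d)
  image? f d j = anyUpTo? (λ k → f k ≟ j) d

  count-image : ∀ {n} (f : ℕ → Fin n) d → (∀ {a b} → a < d → b < d → f a ≡ f b → a ≡ b) →
                count (image? f d) ≡ d
  count-image {n} f zero    f-inj = count-∅ {n} (image? f zero) λ { _ (_ , () , _) }
  count-image {n} f (suc d) f-inj = begin
    count (image? f (suc d))            ≡⟨ count-cong (image? f (suc d)) new∪old split join ⟩
    count new∪old                       ≡⟨ count-∪ (f d ≟_) (image? f d) disjoint ⟩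
    count (f d ≟_) + count (image? f d) ≡⟨ cong₂ _+_ (count-≡ (f d)) (count-image f d f-inj′) ⟩
    suc d                               ∎
    where
    open ≡-Reasoning
    new∪old : Decidable (λ j → f d ≡ j ⊎ Image f d j)
    new∪old = (f d ≟_) ∪? image? f d
    f-inj′ : ∀ {a b} → a < d → b < d → f a ≡ f b → a ≡ b
    f-inj′ a<d b<d = f-inj (m<n⇒m<1+n a<d) (m<n⇒m<1+n b<d)
    split : ∀ {j} → Image f (suc d) j → f d ≡ j ⊎ Image f d j
    split (k , k<1+d , eq) with m<1+n⇒m<n∨m≡n k<1+d
    ... | inj₁ k<d  = inj₂ (k , k<d , eq)
    ... | inj₂ refl = inj₁ eq
    join : ∀ {j} → f d ≡ j ⊎ Image f d j → Image f (suc d) j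
    join (inj₁ eq)             = d , ≤-refl , eq
    join (inj₂ (k , k<d , eq)) = k , m<n⇒m<1+n k<d , eq
    disjoint : ∀ {j} → f d ≡ j → Image f d j → ⊥
    disjoint refl (k , k<d , eq) = <-irrefl (f-inj (m<n⇒m<1+n k<d) ≤-refl eq) k<d

  module Semiregular {u} (σ : Fin u → Fin u) (σ-injective : Injective _≡_ _≡_ σ)
                     (fixes⇒id : ∀ k {i} → iterate σ k i ≡ i → ∀ j → iterate σ k j ≡ j) where

    Closed : ∀ {p} → Pred (Fin u) p → Set p
    Closed P = ∀ {j} → P j → P (σ j)

    closed-iterate : ∀ {p} {P : Pred (Fin u) p} → Closed P → ∀ k {i} → P i → P (iterate σ k i)
    closed-iterate closed zero    Pi = Pi
    closed-iterate {P = P} closed (suc k) {i} Pi =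
      closed {iterate σ k i} (closed-iterate {P = P} closed k Pi)

    iterate-∸-fixed : ∀ {a b} i → a ≤ b → iterate σ a i ≡ iterate σ b i →
                      iterate σ (b ∸ a) i ≡ i
    iterate-∸-fixed {a} {b} i a≤b eq = sym (iterate-injective σ σ-injective a (begin
      iterate σ a i                     ≡⟨ eq ⟩
      iterate σ b i                     ≡⟨ cong (λ k → iterate σ k i) (m+[n∸m]≡n a≤b) ⟨
      iterate σ (a + (b ∸ a)) i         ≡⟨ iterate-+ σ a (b ∸ a) i ⟩
      iterate σ a (iterate σ (b ∸ a) i) ∎))
      where open ≡-Reasoning

    module Orbits (d : ℕ) .{{_ : NonZero d}} (period : ∀ j → iterate σ d j ≡ j)
                  (aperiodic : ∀ {k j} → 0 < k → k < d → iterate σ k j ≢ j) where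

      Orbit : Fin u → Pred (Fin u) 0ℓ
      Orbit i = Image (λ k → iterate σ k i) d

      orbit? : ∀ i → Decidable (Orbit i)
      orbit? i = image? (λ k → iterate σ k i) d

      count-orbit : ∀ i → count (orbit? i) ≡ d
      count-orbit i = count-image (λ k → iterate σ k i) d distinct
        where
        distinct : ∀ {a b} → a < d → b < d → iterate σ a i ≡ iterate σ b i → a ≡ b
        distinct {a} {b} a<d b<d eq with <-cmp a b
        ... | tri< a<b _ _ = ⊥-elim (aperiodic (m<n⇒0<n∸m a<b) (≤-<-trans (m∸n≤m b a) b<d)
                                               (iterate-∸-fixed i (<⇒≤ a<b) eq))
        ... | tri≈ _ a≡b _ = a≡b
        ... | tri> _ _ b<a = ⊥-elim (aperiodic (m<n⇒0<n∸m b<a) (≤-<-trans (m∸n≤m a b) a<d)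
                                               (iterate-∸-fixed i (<⇒≤ b<a) (sym eq)))

      orbit-pred : ∀ {i j} → Orbit i (σ j) → Orbit i j
      orbit-pred {i} {j} (zero , _ , i≡σj) = pred d , ≤-reflexive (suc-pred d) , σ-injective (begin
        σ (iterate σ (pred d) i) ≡⟨ cong (λ k → iterate σ k i) (suc-pred d) ⟩
        iterate σ d i            ≡⟨ period i ⟩
        i                        ≡⟨ i≡σj ⟩
        σ j                      ∎)
        where open ≡-Reasoning
      orbit-pred (suc k , k<d , eq) = k , <-trans (n<1+n k) k<d , σ-injective eq

      orbit⊆ : ∀ {p} {P : Pred (Fin u) p} → Closed P → ∀ {i j} → P i → Orbit i j → P j
      orbit⊆ {P = P} closed Pi (k , _ , refl) = closed-iterate {P = P} closed k Pi

      count-∩orbit : ∀ {p} {P : Pred (Fin u) p} (P? : Decidable P) → Closed P →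
                     ∀ {i} → P i → count (P? ∩? orbit? i) ≡ d
      count-∩orbit {P = P} P? closed {i} Pi =
        trans (count-cong (P? ∩? orbit? i) (orbit? i) proj₂ (λ o → orbit⊆ {P = P} closed Pi o , o))
              (count-orbit i)

      period∣count : ∀ {P : Pred (Fin u) 0ℓ} (P? : Decidable P) → Closed P → d ∣ count P?
      period∣count P? closed = <-rec Motive step (count P?) P? closed refl
        where
        Motive : ℕ → Set₁
        Motive c = ∀ {P : Pred (Fin u) 0ℓ} (P? : Decidable P) → Closed P → count P? ≡ c → d ∣ c
        step : ∀ c → (∀ {c′} → c′ < c → Motive c′) → Motive c
        step c rec {P} P? closed refl with any? P?
        ... | no ∄ = subst (d ∣_) (sym (count-∅ P? λ j Pj → ∄ (j , Pj))) (d ∣0)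
        ... | yes (i , Pi) =
          subst (d ∣_) (sym count-P) (∣m∣n⇒∣m+n ∣-refl (rec smaller rest? rest-closed refl))
          where
          rest? : Decidable (P ∩ ∁ (Orbit i))
          rest? = P? ∩? ∁? (orbit? i)
          count-P : count P? ≡ d + count rest?
          count-P = trans (count-∩∁ P? (orbit? i)) (cong (_+ count rest?) (count-∩orbit P? closed Pi))
          smaller : count rest? < count P?
          smaller = subst (count rest? <_) (sym count-P) (m<n+m (count rest?) (>-nonZero⁻¹ d))
          rest-closed : Closed (P ∩ ∁ (Orbit i))
          rest-closed {j} (Pj , ∉O) = closed {j} Pj , ∉O ∘ orbit-pred

    iterate-size≗id : ∀ i → iterate σ u i ≡ i
    iterate-size≗id i = iterate-∣-fixed σ (period i) d∣u
      where
      Returns : Pred ℕ 0ℓ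
      Returns k = 0 < k × iterate σ k i ≡ i

      returns : ∃[ e ] Returns e
      returns with a , b , a<b , eq ← pigeonhole (n<1+n u) (λ k → iterate σ (toℕ k) i)
        = toℕ b ∸ toℕ a , m<n⇒0<n∸m a<b , iterate-∸-fixed i (<⇒≤ a<b) eq

      first-return : ∃[ d ] Returns d × (∀ {k} → k < d → ¬ Returns k)
      first-return = least (λ k → 0 <? k ×-dec iterate σ k i ≟ i) (proj₂ returns)

      d : ℕ
      d = proj₁ first-return

      instance
        d≢0 : NonZero d
        d≢0 = >-nonZero (proj₁ (proj₁ (proj₂ first-return)))

      period : ∀ j → iterate σ d j ≡ j
      period = fixes⇒id d (proj₂ (proj₁ (proj₂ first-return)))

      aperiodic : ∀ {k j} → 0 < k → k < d → iterate σ k j ≢ j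
      aperiodic {k} 0<k k<d fixed = proj₂ (proj₂ first-return) k<d (0<k , fixes⇒id k fixed i)

      d∣u : d ∣ u
      d∣u = subst (d ∣_) (count-U u)
                  (Orbits.period∣count d period aperiodic (λ _ → yes tt) λ _ → tt)

module BinomialCoefficients where

  open import Data.Empty using (⊥; ⊥-elim)
  open import Data.Nat.Base using (_+_; _*_; _≤_; _<_; NonTrivial)
  open import Data.Nat.Properties
    using (*-zeroʳ; *-distribˡ-+; +-assoc; *-comm; <⇒≱; <-trans; ≤-<-trans)
  open import Data.Nat.Combinatorics using (nCk+nC[k+1]≡[n+1]C[k+1])
  open import Data.Nat.Coprimality using (Coprime; coprime-divisor)
  open import Data.Nat.Divisibility using (∣⇒≤; 0∣⇒≡0; _∣0)
  open import Data.Nat.Divisibility.Core using (hasNonTrivialDivisor)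
  open import Data.Nat.Induction using (<-rec)
  open import Data.Nat.Primality using (Prime; prime?; ¬prime⇒composite; composite)
  open import Relation.Binary.PropositionalEquality

  [1+k]*[1+n]C[1+k]≡[1+n]*nCk : ∀ n k → suc k * (suc n C suc k) ≡ suc n * (n C k)
  [1+k]*[1+n]C[1+k]≡[1+n]*nCk zero    zero    = refl
  [1+k]*[1+n]C[1+k]≡[1+n]*nCk zero    (suc k) = *-zeroʳ (suc (suc k))
  [1+k]*[1+n]C[1+k]≡[1+n]*nCk (suc n) k = begin
    suc k * (suc (suc n) C suc k)
      ≡⟨ cong (suc k *_) (nCk+nC[k+1]≡[n+1]C[k+1] (suc n) k) ⟨
    suc k * (suc n C k + suc n C suc k)
      ≡⟨ *-distribˡ-+ (suc k) (suc n C k) _ ⟩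
    suc k * (suc n C k) + suc k * (suc n C suc k)
      ≡⟨ cong (suc k * (suc n C k) +_) ([1+k]*[1+n]C[1+k]≡[1+n]*nCk n k) ⟩
    suc k * (suc n C k) + suc n * (n C k)
      ≡⟨ +-assoc (suc n C k) (k * (suc n C k)) _ ⟩
    suc n C k + (k * (suc n C k) + suc n * (n C k))
      ≡⟨ cong (suc n C k +_) (k*[1+n]Ck+[1+n]*nCk≡[1+n]*[1+n]Ck k) ⟩
    suc n C k + suc n * (suc n C k)
      ∎
    where
    open ≡-Reasoning
    k*[1+n]Ck+[1+n]*nCk≡[1+n]*[1+n]Ck : ∀ k → k * (suc n C k) + suc n * (n C k) ≡ suc n * (suc n C k)
    k*[1+n]Ck+[1+n]*nCk≡[1+n]*[1+n]Ck zero    = refl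
    k*[1+n]Ck+[1+n]*nCk≡[1+n]*[1+n]Ck (suc k) = begin
      suc k * (suc n C suc k) + suc n * (n C suc k)
        ≡⟨ cong (_+ suc n * (n C suc k)) ([1+k]*[1+n]C[1+k]≡[1+n]*nCk n k) ⟩
      suc n * (n C k) + suc n * (n C suc k)
        ≡⟨ *-distribˡ-+ (suc n) (n C k) (n C suc k) ⟨
      suc n * (n C k + n C suc k)
        ≡⟨ cong (suc n *_) (nCk+nC[k+1]≡[n+1]C[k+1] n k) ⟩
      suc n * (suc n C suc k)
        ∎

  primeFactors≥⇒rough : ∀ {s t} → (∀ q → Prime q → q ∣ s → t ≤ q) → t Rough s
  primeFactors≥⇒rough {s} {t} bound (hasNonTrivialDivisor d<t d∣s) = <-rec Small noSmall _ d<t d∣s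
    where
    Small : ℕ → Set
    Small d = .{{NonTrivial d}} → d < t → d ∣ s → ⊥
    noSmall : ∀ d → (∀ {e} → e < d → Small e) → Small d
    noSmall d rec d<t d∣s with prime? d
    ... | yes d-prime = <⇒≱ d<t (bound d d-prime d∣s)
    ... | no ¬d-prime with composite e<d e∣d ← ¬prime⇒composite ¬d-prime
      = rec e<d (<-trans e<d d<t) (∣-trans e∣d d∣s)

  rough⇒coprime : ∀ {s t r} → t Rough s → suc r < t → Coprime s (suc r)
  rough⇒coprime rough r<t {zero}        (_ , 0∣r)   with () ← 0∣⇒≡0 0∣r
  rough⇒coprime rough r<t {1}           _           = refl
  rough⇒coprime rough r<t {suc (suc d)} (d∣s , d∣r) =
    ⊥-elim (rough (hasNonTrivialDivisor (≤-<-trans (∣⇒≤ d∣r) r<t) d∣s))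

  rough⇒∣C : ∀ {s t r} → t Rough s → suc r < t → s ∣ s C suc r
  rough⇒∣C {zero}          rough r<t = 0 ∣0  -- 0 C suc r reduces to 0
  rough⇒∣C {suc s} {r = r} rough r<t =
    coprime-divisor (rough⇒coprime rough r<t)
      (divides (s C r) (trans ([1+k]*[1+n]C[1+k]≡[1+n]*nCk s r) (*-comm (suc s) (s C r))))

open Combinatorics
open BinomialCoefficients

module _ {c ℓ : Level} (R : Ring c ℓ) where

  open Ring R hiding (zero)
  open RingDefs R
  open import Data.Unit.Polymorphic using (tt)
  open import Algebra.Properties.AbelianGroup +-abelianGroup
    using (x∙y⁻¹≈ε⇒x≈y; x≈y⇒x∙y⁻¹≈ε; ⁻¹-anti-homo‿-; xyx⁻¹≈y; //-rightDividesˡ)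
  open import Algebra.Properties.RingWithoutOne ringWithoutOne using (x[y-z]≈xy-xz; [y-z]x≈yx-zx)
  open import Algebra.Properties.Semiring.Exp semiring using (^-homo-*; ^-assocʳ; ^-congˡ)
  open import Algebra.Properties.Semiring.Mult semiring using (×-assoc-*; ×-assocˡ; ×-homo-1; ×-congʳ)
  open import Algebra.Properties.Semiring.Sum semiring using (sum)
  import Relation.Binary.Reasoning.Setoid as SetoidReasoning

  -‿telescope : ∀ x y z → (x - y) + (y - z) ≈ x - z
  -‿telescope x y z = begin
    (x - y) + (y - z)     ≈⟨ +-assoc x (- y) (y - z) ⟩
    x + (- y + (y - z))   ≈⟨ +-congˡ (+-assoc (- y) y (- z)) ⟨
    x + ((- y + y) - z)   ≈⟨ +-congˡ (+-congʳ (-‿inverseˡ y)) ⟩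
    x + (0# - z)          ≈⟨ +-congˡ (+-identityˡ (- z)) ⟩
    x - z                 ∎
    where open SetoidReasoning setoid

  1^n≈1 : ∀ n → 1# ^ n ≈ 1#
  1^n≈1 zero    = refl
  1^n≈1 (suc n) = trans (*-identityˡ (1# ^ n)) (1^n≈1 n)

  ∣⇒^≈1 : ∀ {x m n} → m ∣ n → x ^ m ≈ 1# → x ^ n ≈ 1#
  ∣⇒^≈1 {x} {m} (divides q ≡.refl) xᵐ≈1 = begin
    x ^ (q ℕ.* m) ≡⟨ ≡.cong (x ^_) (ℕ.*-comm q m) ⟩
    x ^ (m ℕ.* q) ≈⟨ ^-assocʳ x m q ⟨
    (x ^ m) ^ q   ≈⟨ ^-congˡ q xᵐ≈1 ⟩
    1# ^ q        ≈⟨ 1^n≈1 q ⟩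
    1#            ∎
    where open SetoidReasoning setoid

  infix 4 _∼[_]_
  _∼[_]_ : ∀ {p} → Carrier → Ideal p → Carrier → Set p
  x ∼[ N ] y = mem N (x - y)

  module IdealProperties {p} (N : Ideal p) where

    open IsIdeal (isIdeal N) public

    ≈⇒∼ : ∀ {x y} → x ≈ y → x ∼[ N ] y
    ≈⇒∼ x≈y = resp (sym (x≈y⇒x∙y⁻¹≈ε x≈y)) zero∈

    ∼-sym : ∀ {x y} → x ∼[ N ] y → y ∼[ N ] x
    ∼-sym {x} {y} x∼y = resp (⁻¹-anti-homo‿- x y) (-∈ x∼y)

    ∼-trans : ∀ {x y z} → x ∼[ N ] y → y ∼[ N ] z → x ∼[ N ] z
    ∼-trans {x} {y} {z} x∼y y∼z = resp (-‿telescope x y z) (+∈ x∼y y∼z)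

    ∼-setoid : Setoid c p
    ∼-setoid = record
      { _≈_ = _∼[ N ]_
      ; isEquivalence = record { refl = ≈⇒∼ refl ; sym = ∼-sym ; trans = ∼-trans }
      }

    *-congˡ-∼ : ∀ z {x y} → x ∼[ N ] y → z * x ∼[ N ] z * y
    *-congˡ-∼ z {x} {y} x∼y = resp (x[y-z]≈xy-xz z x y) (*ˡ∈ z x∼y)

    *-congʳ-∼ : ∀ z {x y} → x ∼[ N ] y → x * z ∼[ N ] y * z
    *-congʳ-∼ z {x} {y} x∼y = resp ([y-z]x≈yx-zx z x y) (*ʳ∈ z x∼y)

    ∼-respˡ : ∀ {x x′ y} → x ≈ x′ → x ∼[ N ] y → x′ ∼[ N ] y
    ∼-respˡ x≈x′ = resp (+-congʳ x≈x′)

    ·ₙ∈ : ∀ n {x} → mem N x → mem N (n ·ₙ x)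
    ·ₙ∈ zero    x∈N = zero∈
    ·ₙ∈ (suc n) x∈N = +∈ x∈N (·ₙ∈ n x∈N)

    sum∈ : ∀ {n} (f : Fin n → Carrier) → (∀ i → mem N (f i)) → mem N (sum f)
    sum∈ {zero}  f f∈N = zero∈
    sum∈ {suc n} f f∈N = +∈ (f∈N zero) (sum∈ (f ∘ suc) (f∈N ∘ suc))

    open SetoidReasoning ∼-setoid

    unit-sandwich : ∀ {x y z w} → x * y ∼[ N ] 1# → z * w ∼[ N ] 1# →
                    (x * z) * (w * y) ∼[ N ] 1#
    unit-sandwich {x} {y} {z} {w} xy∼1 zw∼1 = begin
      (x * z) * (w * y)   ≈⟨ ≈⇒∼ (trans (*-assoc x z (w * y)) (*-congˡ (sym (*-assoc z w y)))) ⟩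
      x * ((z * w) * y)   ≈⟨ *-congˡ-∼ x (*-congʳ-∼ y zw∼1) ⟩
      x * (1# * y)        ≈⟨ ≈⇒∼ (*-congˡ (*-identityˡ y)) ⟩
      x * y               ≈⟨ xy∼1 ⟩
      1#                  ∎

    IsUnitMod-* : ∀ {x z} → IsUnitMod N x → IsUnitMod N z → IsUnitMod N (x * z)
    IsUnitMod-* (y , xy∼1 , yx∼1) (w , zw∼1 , wz∼1) =
      w * y , unit-sandwich xy∼1 zw∼1 , unit-sandwich wz∼1 yx∼1

    *-cancelˡ-∼ : ∀ {g x y} → IsUnitMod N g → g * x ∼[ N ] g * y → x ∼[ N ] y
    *-cancelˡ-∼ {g} {x} {y} (h , _ , hg∼1) gx∼gy = begin
      x             ≈⟨ ≈⇒∼ (*-identityˡ x) ⟨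
      1# * x        ≈⟨ *-congʳ-∼ x hg∼1 ⟨
      h * g * x     ≈⟨ ≈⇒∼ (*-assoc h g x) ⟩
      h * (g * x)   ≈⟨ *-congˡ-∼ h gx∼gy ⟩
      h * (g * y)   ≈⟨ ≈⇒∼ (*-assoc h g y) ⟨
      h * g * y     ≈⟨ *-congʳ-∼ y hg∼1 ⟩
      1# * y        ≈⟨ ≈⇒∼ (*-identityˡ y) ⟩
      y             ∎

    *-cancelʳ-∼ : ∀ {g x y} → IsUnitMod N g → x * g ∼[ N ] y * g → x ∼[ N ] y
    *-cancelʳ-∼ {g} {x} {y} (h , gh∼1 , _) xg∼yg = begin
      x             ≈⟨ ≈⇒∼ (*-identityʳ x) ⟨
      x * 1#        ≈⟨ *-congˡ-∼ x gh∼1 ⟨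
      x * (g * h)   ≈⟨ ≈⇒∼ (*-assoc x g h) ⟨
      x * g * h     ≈⟨ *-congʳ-∼ h xg∼yg ⟩
      y * g * h     ≈⟨ ≈⇒∼ (*-assoc y g h) ⟩
      y * (g * h)   ≈⟨ *-congˡ-∼ y gh∼1 ⟩
      y * 1#        ≈⟨ ≈⇒∼ (*-identityʳ y) ⟩
      y             ∎

  lagrange : ∀ {p} {N : Ideal p} {u y} → UnitsModCard N u → IsUnit y → y ^ u ∼[ N ] 1#
  lagrange {N = N} {u} {y} (f , f-unit , f-injective , f-surjective) (w , yw≈1 , wy≈1) =
    fixed⇒y^k∼1 u (Semiregular.iterate-size≗id σ σ-injective fixes⇒id i₁)
    where
    open IdealProperties N
    open SetoidReasoning ∼-setoid

    y-unit : IsUnitMod N y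
    y-unit = w , ≈⇒∼ yw≈1 , ≈⇒∼ wy≈1

    σ : Fin u → Fin u
    σ i = proj₁ (f-surjective (y * f i) (IsUnitMod-* y-unit (f-unit i)))

    y*f∼f∘σ : ∀ i → y * f i ∼[ N ] f (σ i)
    y*f∼f∘σ i = proj₂ (f-surjective (y * f i) (IsUnitMod-* y-unit (f-unit i)))

    y^k*f∼f∘σ^k : ∀ k i → y ^ k * f i ∼[ N ] f (iterate σ k i)
    y^k*f∼f∘σ^k zero    i = ≈⇒∼ (*-identityˡ (f i))
    y^k*f∼f∘σ^k (suc k) i = begin
      y * y ^ k * f i         ≈⟨ ≈⇒∼ (*-assoc y (y ^ k) (f i)) ⟩
      y * (y ^ k * f i)       ≈⟨ *-congˡ-∼ y (y^k*f∼f∘σ^k k i) ⟩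
      y * f (iterate σ k i)   ≈⟨ y*f∼f∘σ (iterate σ k i) ⟩
      f (iterate σ (suc k) i) ∎

    σ-injective : Injective _≡_ _≡_ σ
    σ-injective {i} {j} σi≡σj = f-injective i j (*-cancelˡ-∼ y-unit (begin
      y * f i   ≈⟨ y*f∼f∘σ i ⟩
      f (σ i)   ≡⟨ ≡.cong f σi≡σj ⟩
      f (σ j)   ≈⟨ y*f∼f∘σ j ⟨
      y * f j   ∎))

    fixed⇒y^k∼1 : ∀ k {i} → iterate σ k i ≡ i → y ^ k ∼[ N ] 1#
    fixed⇒y^k∼1 k {i} fixed = *-cancelʳ-∼ (f-unit i) (begin
      y ^ k * f i           ≈⟨ y^k*f∼f∘σ^k k i ⟩
      f (iterate σ k i)     ≡⟨ ≡.cong f fixed ⟩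
      f i                   ≈⟨ ≈⇒∼ (*-identityˡ (f i)) ⟨
      1# * f i              ∎)

    fixes⇒id : ∀ k {i} → iterate σ k i ≡ i → ∀ j → iterate σ k j ≡ j
    fixes⇒id k fixed j = f-injective _ _ (begin
      f (iterate σ k j)    ≈⟨ y^k*f∼f∘σ^k k j ⟨
      y ^ k * f j          ≈⟨ *-congʳ-∼ (f j) (fixed⇒y^k∼1 k fixed) ⟩
      1# * f j             ≈⟨ ≈⇒∼ (*-identityˡ (f j)) ⟩
      f j                  ∎)

    i₁ : Fin u
    i₁ = proj₁ (f-surjective 1# (1# , ≈⇒∼ (*-identityˡ 1#) , ≈⇒∼ (*-identityˡ 1#)))

  ^-comm-* : ∀ x n → x ^ n * x ≈ x * x ^ n
  ^-comm-* x zero    = trans (*-identityˡ x) (sym (*-identityʳ x))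
  ^-comm-* x (suc n) = trans (*-assoc x (x ^ n) x) (*-congˡ (^-comm-* x n))

  ^∈IdealPow : ∀ {p} (N : Ideal p) {a} → mem N a → ∀ r → IdealPow (mem N) r (a ^ r)
  ^∈IdealPow N     a∈N zero          = tt
  ^∈IdealPow N {a} a∈N (suc zero)    = lift (IsIdeal.resp (isIdeal N) (sym (*-identityʳ a)) a∈N)
  ^∈IdealPow N {a} a∈N (suc (suc r)) =
    rsp (^-comm-* a (suc r)) (prod (^∈IdealPow N a∈N (suc r)) a∈N)

  module _ {p} {N N′ : Ideal p} {t s : ℕ}
           (Nᵗ⊆N′ : IdealPow (mem N) t ⊆ mem N′) (adm : AdmChar N N′ t s) where

    open IdealProperties N′

    private
      s·N⊆N′ : ∀ {a} → mem N a → mem N′ (s ·ₙ a)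
      s·N⊆N′ = proj₁ (proj₂ adm)

      t-rough : t Rough s
      t-rough = primeFactors≥⇒rough (proj₂ (proj₂ adm))

    ^≥t∈ : ∀ {a} → mem N a → ∀ r → t ℕ.≤ r → mem N′ (a ^ r)
    ^≥t∈ {a} a∈N r t≤r = resp a^[r∸t]*a^t≈a^r (*ˡ∈ (a ^ (r ∸ t)) (Nᵗ⊆N′ (^∈IdealPow N a∈N t)))
      where
      a^[r∸t]*a^t≈a^r : a ^ (r ∸ t) * a ^ t ≈ a ^ r
      a^[r∸t]*a^t≈a^r =
        trans (sym (^-homo-* a (r ∸ t) t)) (reflexive (≡.cong (a ^_) (ℕ.m∸n+n≡m t≤r)))

    C·ₙ^∈ : ∀ {a} → mem N a → ∀ r → mem N′ ((s C suc r) ·ₙ a ^ suc r)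
    C·ₙ^∈ {a} a∈N r with suc r ℕ.<? t
    ... | no  r≮t = ·ₙ∈ (s C suc r) (^≥t∈ a∈N (suc r) (ℕ.≮⇒≥ r≮t))
    ... | yes r<t with divides q sCr≡q*s ← rough⇒∣C t-rough r<t
      = resp (begin
          q ·ₙ ((s ·ₙ a) * a ^ r)   ≈⟨ ×-congʳ q (×-assoc-* s a (a ^ r)) ⟩
          q ·ₙ (s ·ₙ a ^ suc r)     ≈⟨ ×-assocˡ (a ^ suc r) q s ⟩
          (q ℕ.* s) ·ₙ a ^ suc r     ≡⟨ ≡.cong (_·ₙ a ^ suc r) sCr≡q*s ⟨
          (s C suc r) ·ₙ a ^ suc r   ∎)
        (·ₙ∈ q (*ʳ∈ (a ^ r) (s·N⊆N′ a∈N)))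
      where open SetoidReasoning setoid

    ∼1⇒^s∼1 : ∀ {x} → x ∼[ N ] 1# → x ^ s ∼[ N′ ] 1#
    ∼1⇒^s∼1 {x} x-1∈N =
      resp (sym expansion) (sum∈ higherTerms λ k → resp (term≈ k) (C·ₙ^∈ x-1∈N (toℕ k)))
      where
      a : Carrier
      a = x - 1#
      open import Algebra.Properties.Semiring.Binomial semiring a 1# using (binomialTerm; theorem)
      open SetoidReasoning setoid

      higherTerms : Fin s → Carrier
      higherTerms k = binomialTerm s (suc k)

      term≈ : ∀ k → (s C suc (toℕ k)) ·ₙ a ^ suc (toℕ k) ≈ higherTerms k
      term≈ k = ×-congʳ (s C suc (toℕ k))
                        (sym (trans (*-congˡ (1^n≈1 (s ∸ suc (toℕ k)))) (*-identityʳ _)))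

      expansion : x ^ s - 1# ≈ sum higherTerms
      expansion = begin
        x ^ s - 1#                                 ≈⟨ +-congʳ (^-congˡ s x≈a+1) ⟩
        (a + 1#) ^ s - 1#                          ≈⟨ +-congʳ (theorem a*1≈1*a s) ⟩
        binomialTerm s zero + sum higherTerms - 1# ≈⟨ +-congʳ (+-congʳ lowestTerm≈1) ⟩
        1# + sum higherTerms - 1#                  ≈⟨ xyx⁻¹≈y 1# (sum higherTerms) ⟩
        sum higherTerms                            ∎
        where
        x≈a+1 : x ≈ a + 1#
        x≈a+1 = sym (//-rightDividesˡ 1# x)
        a*1≈1*a : a * 1# ≈ 1# * a
        a*1≈1*a = trans (*-identityʳ a) (sym (*-identityˡ a))
        lowestTerm≈1 : binomialTerm s zero ≈ 1#
        lowestTerm≈1 = trans (×-homo-1 _) (trans (*-identityˡ _) (1^n≈1 s))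

  ∼1⇒^prod∼1 : ∀ {p} k (N : Fin (suc k) → Ideal p) (s : Fin k → ℕ) →
               (∀ l {x} → x ∼[ N (inject₁ l) ] 1# → x ^ s l ∼[ N (suc l) ] 1#) →
               ∀ {x} → x ∼[ N zero ] 1# → x ^ prodFin k s ∼[ N (fromℕ k) ] 1#
  ∼1⇒^prod∼1 zero    N s step {x} x∼1 =
    IdealProperties.∼-respˡ (N zero) (sym (*-identityʳ x)) x∼1
  ∼1⇒^prod∼1 (suc k) N s step {x} x∼1 =
    IdealProperties.∼-respˡ (N (fromℕ (suc k))) (^-assocʳ x (s zero) (prodFin k (s ∘ suc)))
      (∼1⇒^prod∼1 k (N ∘ suc) (s ∘ suc) (step ∘ suc) (step zero x∼1))

  CNC⇒^prod≈1 : ∀ {p k} {N : Fin (suc k) → Ideal p} {t s} → CNC k N t s →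
                ∀ {x} → x ∼[ N zero ] 1# → x ^ prodFin k s ≈ 1#
  CNC⇒^prod≈1 {k = k} {N} {s = s} cnc x∼1 =
    x∙y⁻¹≈ε⇒x≈y _ 1# (last-zero (∼1⇒^prod∼1 k N s step x∼1))
    where
    open CNC cnc
    step : ∀ l {x} → x ∼[ N (inject₁ l) ] 1# → x ^ s l ∼[ N (suc l) ] 1#
    step l = ∼1⇒^s∼1 {N = N (inject₁ l)} {N (suc l)}
                     (proj₁ (proj₂ (nilIndex l))) (proj₁ (charac l))

  unit^[u*prod]≈1 : ∀ {p k} {N : Fin (suc k) → Ideal p} {t s u y} → CNC k N t s →
                    UnitsModCard (N zero) u → IsUnit y → y ^ (u ℕ.* prodFin k s) ≈ 1#
  unit^[u*prod]≈1 {k = k} {N} {s = s} {u} {y} cnc card y-unit =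
    trans (sym (^-assocʳ y u (prodFin k s))) (CNC⇒^prod≈1 cnc (lagrange {N = N zero} card y-unit))

open import Data.Nat.Base using (_*_)

∣lcmFin : ∀ n (m : Fin n → ℕ) i → m i ∣ lcmFin n m
∣lcmFin (suc n) m zero    = m∣lcm[m,n] (m zero) _
∣lcmFin (suc n) m (suc i) = ∣-trans (∣lcmFin n (m ∘ suc) i) (n∣lcm[m,n] (m zero) _)

theorem3p3 : {c ℓ p : Level} (j : ℕ) (R : Fin j → Ring c ℓ)
    (k′ : Fin j → ℕ)
    (N : (i : Fin j) → Fin (suc (k′ i)) → RingDefs.Ideal (R i) p)
    (t s : (i : Fin j) → Fin (k′ i) → ℕ)
    → (∀ i → RingDefs.CNC (R i) (k′ i) (N i) (t i) (s i))
    → (u : Fin j → ℕ)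
    → (∀ i → RingDefs.UnitsModCard (R i) (N i zero) (u i))
    → let m : Fin j → ℕ
          m i = u i * prodFin (k′ i) (s i)
          M = lcmFin j m
      in (y : (i : Fin j) → Ring.Carrier (R i))
         → (∀ i → RingDefs.IsUnit (R i) (y i))
         → ∀ i → Ring._≈_ (R i) (RingDefs._^_ (R i) (y i) M) (Ring.1# (R i))
theorem3p3 j R k′ N t s cnc u card y y-unit i =
  ∣⇒^≈1 (R i) (∣lcmFin j m i) (unit^[u*prod]≈1 (R i) (cnc i) (card i) (y-unit i))
  where
  m : Fin j → ℕ
  m i = u i * prodFin (k′ i) (s i)
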